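{- Let $V_T$ be a set of terminals, $V_N=\{0,1,\dots,n\}$ a finite set of nonterminals, $\Delta$ the set of PEG expressions over $V_T,V_N$, and $P_{exp}:V_N\to\Delta$ a map assigning to each nonterminal its defining expression. For all coherent property maps $P,P'\in\mathbb{C}$ and every nonterminal $A\in V_N$: if $P\le P'$ then $\rho(A,P)\le\rho(A,P')$.
   Context: PEG expressions $\Delta$ are generated by: $\epsilon$ (empty), $[\cdot]$ (any character), $[a]$ for $a\in V_T$, $A$ for $A\in V_N$, $e_1;e_2$ (sequence), $e_1/e_2$ (prioritized choice), $e*$ (repetition), $!e$ (not-predicate). A property map is a function $P:V_N\to\{\mathrm{true},\mathrm{false}\}^3$; write $\mathbb{P}$ for the set of all property maps, with components $P(A)=(P(A)_1,P(A)_2,P(A)_3)$ (meaning "known that it can fail", "known that it can succeed without consuming input", "known that it can succeed by consuming input"). Order: $P\le P'$ iff for all $A\in V_N$ and $i\in\{1,2,3\}$, $P(A)_i\Rightarrow P'(A)_i$. Define $g:\Delta\times\mathbb{P}\to\{\mathrm{true},\mathrm{false}\}^3$, writing $g(e,P)=(\bot(e),z(e),c(e))$, recursively: $g(\epsilon,P)=(\mathrm{false},\mathrm{true},\mathrm{false})$; $g([\cdot],P)=g([a],P)=(\mathrm{true},\mathrm{false},\mathrm{true})$; $g(A,P)=P(A)$; for $e_1;e_2$: $\bot=\bot(e_1)\vee((z(e_1)\vee c(e_1))\wedge\bot(e_2))$, $z=z(e_1)\wedge z(e_2)$, $c=(c(e_1)\wedge(z(e_2)\vee c(e_2)))\vee(z(e_1)\wedge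 c(e_2))$; for $e_1/e_2$: $\bot=\bot(e_1)\wedge\bot(e_2)$, $z=z(e_1)\vee(\bot(e_1)\wedge z(e_2))$, $c=c(e_1)\vee(\bot(e_1)\wedge c(e_2))$; for $e*$: $\bot=\mathrm{false}$, $z=\bot(e)$, $c=c(e)$; for $!e$: $\bot=z(e)\vee c(e)$, $z=\bot(e)$, $c=\mathrm{false}$. Define $\rho:V_N\times\mathbb{P}\to\mathbb{P}$ by $\rho(A,P)(A)=g(P_{exp}(A),P)$ and $\rho(A,P)(B)=P(B)$ for $B\ne A$. The set of coherent property maps is $\mathbb{C}=\{P\in\mathbb{P}:\forall A\in V_N,\ P\le\rho(A,P)\}$. -}

module Defs where

open import Data.Bool using (Bool; true; false; _∧_; _∨_; T)
open import Data.Product using (_×_; _,_; proj₁; proj₂)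
open import Data.Nat using (ℕ; suc)
open import Data.Fin using (Fin; _≟_)
open import Relation.Nullary using (yes; no)

data PEG (VT : Set) (VN : Set) : Set where
  ε    : PEG VT VN
  any  : PEG VT VN
  term : VT → PEG VT VN
  nt   : VN → PEG VT VN
  _︔_  : PEG VT VN → PEG VT VN → PEG VT VN
  _／_  : PEG VT VN → PEG VT VN → PEG VT VN
  _✱   : PEG VT VN → PEG VT VN
  !_   : PEG VT VN → PEG VT VN

-- triples (fail, succeed-without-consuming, succeed-consuming)
Triple : Set
Triple = Bool × Bool × Bool

π₁ π₂ π₃ : Triple → Bool
π₁ t = proj₁ t
π₂ t = proj₁ (proj₂ t)
π₃ t = proj₂ (proj₂ t)

PropMap : ℕ → Set
PropMap n = Fin (suc n) → Triple

_≤P_ : {n : ℕ} → PropMap n → PropMap n → Set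
_≤P_ {n} P P' = (A : Fin (suc n)) →
  (T (π₁ (P A)) → T (π₁ (P' A))) ×
  (T (π₂ (P A)) → T (π₂ (P' A))) ×
  (T (π₃ (P A)) → T (π₃ (P' A)))

g : {VT : Set} {n : ℕ} → PEG VT (Fin (suc n)) → PropMap n → Triple
g ε P = false , true , false
g any P = true , false , true
g (term a) P = true , false , true
g (nt A) P = P A
g (e₁ ︔ e₂) P with g e₁ P | g e₂ P
... | (f₁ , z₁ , c₁) | (f₂ , z₂ , c₂) =
  (f₁ ∨ ((z₁ ∨ c₁) ∧ f₂)) , (z₁ ∧ z₂) , ((c₁ ∧ (z₂ ∨ c₂)) ∨ (z₁ ∧ c₂))
g (e₁ ／ e₂) P with g e₁ P | g e₂ P
... | (f₁ , z₁ , c₁) | (f₂ , z₂ , c₂) =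
  (f₁ ∧ f₂) , (z₁ ∨ (f₁ ∧ z₂)) , (c₁ ∨ (f₁ ∧ c₂))
g (e ✱) P with g e P
... | (f , z , c) = false , f , c
g (! e) P with g e P
... | (f , z , c) = (z ∨ c) , f , false

ρ : {VT : Set} {n : ℕ} → (Fin (suc n) → PEG VT (Fin (suc n))) →
    Fin (suc n) → PropMap n → PropMap n
ρ Pexp A P B with B ≟ A
... | yes _ = g (Pexp A) P
... | no  _ = P B

Coherent : {VT : Set} {n : ℕ} → (Fin (suc n) → PEG VT (Fin (suc n))) → PropMap n → Set
Coherent {n = n} Pexp P = (A : Fin (suc n)) → P ≤P ρ Pexp A P

-- The analysis function g is built from the nonterminal lookup P A and the
-- monotone connectives ∧ and ∨ (negation never occurs), so it is monotone
-- in P by structural induction; ρ only replaces one entry of P by such a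
-- value.
module Submission where

open import Defs
open import Data.Nat using (ℕ; suc)
open import Data.Fin using (Fin; _≟_)
open import Data.Bool using (Bool; _∧_; _∨_; T)
open import Data.Bool.Properties using (T-∧; T-∨)
open import Data.Product using (_×_; _,_) renaming (map to map-×)
open import Data.Sum using () renaming (map to map-⊎)
open import Function using (id; _∘_)
open import Function.Bundles using (Equivalence)
open import Relation.Nullary using (yes; no)

open Equivalence

_⇒_ : Bool → Bool → Set
a ⇒ b = T a → T b

∧-mono-⇒ : ∀ {a b c d} → a ⇒ c → b ⇒ d → (a ∧ b) ⇒ (c ∧ d)
∧-mono-⇒ {a} {b} {c} {d} p q =
  from (T-∧ {c} {d}) ∘ map-× p q ∘ to (T-∧ {a} {b})

∨-mono-⇒ : ∀ {a b c d} → a ⇒ c → b ⇒ d → (a ∨ b) ⇒ (c ∨ d)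
∨-mono-⇒ {a} {b} {c} {d} p q =
  from (T-∨ {c} {d}) ∘ map-⊎ p q ∘ to (T-∨ {a} {b})

_≤T_ : Triple → Triple → Set
t ≤T u = (π₁ t ⇒ π₁ u) × (π₂ t ⇒ π₂ u) × (π₃ t ⇒ π₃ u)

≤T-refl : ∀ {t} → t ≤T t
≤T-refl = id , id , id

g-mono : {VT : Set} {n : ℕ} (e : PEG VT (Fin (suc n))) {P P' : PropMap n} →
         P ≤P P' → g e P ≤T g e P'
g-mono ε        P≤P' = ≤T-refl
g-mono any      P≤P' = ≤T-refl
g-mono (term a) P≤P' = ≤T-refl
g-mono (nt A)   P≤P' = P≤P' A
g-mono (e₁ ︔ e₂) {P} {P'} P≤P'
  with g e₁ P | g e₂ P | g e₁ P' | g e₂ P' | g-mono e₁ P≤P' | g-mono e₂ P≤P'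
... | _ | _ | _ | _ | f₁ , z₁ , c₁ | f₂ , z₂ , c₂ =
  ∨-mono-⇒ f₁ (∧-mono-⇒ (∨-mono-⇒ z₁ c₁) f₂) ,
  ∧-mono-⇒ z₁ z₂ ,
  ∨-mono-⇒ (∧-mono-⇒ c₁ (∨-mono-⇒ z₂ c₂)) (∧-mono-⇒ z₁ c₂)
g-mono (e₁ ／ e₂) {P} {P'} P≤P'
  with g e₁ P | g e₂ P | g e₁ P' | g e₂ P' | g-mono e₁ P≤P' | g-mono e₂ P≤P'
... | _ | _ | _ | _ | f₁ , z₁ , c₁ | f₂ , z₂ , c₂ =
  ∧-mono-⇒ f₁ f₂ , ∨-mono-⇒ z₁ (∧-mono-⇒ f₁ z₂) , ∨-mono-⇒ c₁ (∧-mono-⇒ f₁ c₂)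
g-mono (e ✱) {P} {P'} P≤P' with g e P | g e P' | g-mono e P≤P'
... | _ | _ | f , z , c = id , f , c
g-mono (! e) {P} {P'} P≤P' with g e P | g e P' | g-mono e P≤P'
... | _ | _ | f , z , c = ∨-mono-⇒ z c , f , id

ρ-mono : {VT : Set} {n : ℕ} (Pexp : Fin (suc n) → PEG VT (Fin (suc n)))
         (A : Fin (suc n)) {P P' : PropMap n} →
         P ≤P P' → ρ Pexp A P ≤P ρ Pexp A P'
ρ-mono Pexp A P≤P' B with B ≟ A
... | yes _ = g-mono (Pexp A) P≤P'
... | no _  = P≤P' B

lemma3p1 : (VT : Set) (n : ℕ) (Pexp : Fin (suc n) → PEG VT (Fin (suc n)))
           (P P' : PropMap n) → Coherent Pexp P → Coherent Pexp P' →
           (A : Fin (suc n)) → P ≤P P' → ρ Pexp A P ≤P ρ Pexp A P'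
lemma3p1 VT n Pexp P P' _ _ A = ρ-mono Pexp A
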